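{- Let $T$ be a tableau and let $x,y$ be distinct elements of the totally ordered label set, neither of which is a label of $T$. Then the column trail of the column insertion $x\to T$ and the row trail of the row insertion $T\leftarrow y$ have at most one box in common.
   Context: Tableaux use the French convention. A tableau $T$ consists of a finite set $D$ of boxes $(c,r)\in\{1,2,\dots\}^2$ ($c$ = column, $r$ = row; row $1$ is the bottom row, "north" means larger row index) which is a lower order ideal for the componentwise order, together with an injective labelling of $D$ by elements of a totally ordered set such that labels strictly increase from left to right along each row and from bottom to top along each column. Row insertion of an element $x$ into a row $L$ (an increasing sequence, $x\notin L$): if $L$ is empty or $x>\max L$, $x$ is appended at the end of $L$; otherwise the smallest element $z$ of $L$ with $z>x$ is replaced by $x$, and $z$ is said to be bumped. The row insertion $T\leftarrow x$ ($x$ not a label of $T$) inserts $x$ into row $1$; if an element is bumped it is inserted into row $2$, and so on, until no element is bumped (the last inserted element then occupies a new box at the end of its row, possibly a new row). Column insertion $x\to T$ is defined symmetrically, with columns in place of rows (column $1$ is the leftmost column, and inserting into a column appends at its top when the inserted element exceeds all its entries). The row trail of $T\leftarrow x$ is the sequence of boxes of $T$ whose labels are bumped during the insertion, in the order in which they are bumped, each with its label in $T$, followed by the newly created box (not in $T$, unlabelled), called the empty box of the trail. The column trail of $x\to T$ is defined symmetrically. -}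

module Defs where

open import Level using (Level)
open import Data.Nat using (ℕ; zero; suc)
open import Data.Product using (_×_; _,_; proj₁)
open import Data.Maybe using (Maybe; just; nothing)
open import Data.List using (List; []; _∷_; length; map; mapMaybe; upTo; concat)
open import Data.List.Relation.Unary.All using (All)
open import Data.List.Relation.Unary.Linked using (Linked)
open import Data.List.Relation.Unary.Unique.Propositional using (Unique)
open import Relation.Binary.Core using (Rel)
open import Relation.Binary.Structures using (IsStrictTotalOrder)
open import Relation.Binary.PropositionalEquality using (_≡_)
open import Relation.Nullary using (yes; no; ¬_)
open import Data.Nat using (_≤_)

-- A box (c , r): c = column, r = row, both 1-based; row 1 is the bottom row.
Box : Set
Box = ℕ × ℕ

nth : ∀ {a} {A : Set a} → ℕ → List A → Maybe A
nth _ [] = nothing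
nth zero (x ∷ _) = just x
nth (suc i) (_ ∷ xs) = nth i xs

module Tableaux {a ℓ} {A : Set a} {_<_ : Rel A ℓ}
                (sto : IsStrictTotalOrder _≡_ _<_) where

  open IsStrictTotalOrder sto using (_<?_)

  -- A tableau is represented by its list of rows, row 1 (bottom) first;
  -- each row is listed from left to right (column 1 first).
  Rows : Set a
  Rows = List (List A)

  data LengthsDecr : Rows → Set a where
    []  : LengthsDecr []
    [_] : ∀ R → LengthsDecr (R ∷ [])
    _∷_ : ∀ {R R' Rs} → length R' ≤ length R → LengthsDecr (R' ∷ Rs) → LengthsDecr (R ∷ R' ∷ Rs)

  ColumnStrict : List A → List A → Set (a Level.⊔ ℓ)
  ColumnStrict R R' = ∀ i u v → nth i R ≡ just u → nth i R' ≡ just v → u < v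

  data ColumnsIncr : Rows → Set (a Level.⊔ ℓ) where
    []  : ColumnsIncr []
    [_] : ∀ R → ColumnsIncr (R ∷ [])
    _∷_ : ∀ {R R' Rs} → ColumnStrict R R' → ColumnsIncr (R' ∷ Rs) → ColumnsIncr (R ∷ R' ∷ Rs)

  NonEmpty : List A → Set a
  NonEmpty R = ¬ (R ≡ [])

  -- The shape {(c,r) : r ≤ #rows, c ≤ length of row r} is a lower order ideal
  -- (nonempty rows with weakly decreasing lengths), rows strictly increase,
  -- columns strictly increase, and the labelling is injective.
  record IsTableau (T : Rows) : Set (a Level.⊔ ℓ) where
    field
      rowsNonEmpty : All NonEmpty T
      shape        : LengthsDecr T
      rowsIncr     : All (Linked _<_) T
      colsIncr     : ColumnsIncr T
      injective    : Unique (concat T)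

  labels : Rows → List A
  labels = concat

  columns : Rows → List (List A)
  columns [] = []
  columns (R ∷ Rs) = map (λ i → mapMaybe (nth i) (R ∷ Rs)) (upTo (length R))

  -- insertion of x into an increasing sequence L:
  -- returns the (1-based) position affected, and the bumped element, if any
  insSeq : A → List A → ℕ × Maybe A
  insSeq x [] = 1 , nothing
  insSeq x (z ∷ zs) with x <? z
  ... | yes _ = 1 , just z
  ... | no _ with insSeq x zs
  ...   | p , b = suc p , b

  -- A trail: list of boxes, each with its label in T (just label) for bumped
  -- boxes, and `nothing` for the final (empty) box.
  Trail : Set a
  Trail = List (Box × Maybe A)

  rowTrail′ : ℕ → A → Rows → Trail
  rowTrail′ r x [] = ((1 , r) , nothing) ∷ []
  rowTrail′ r x (L ∷ Ls) with insSeq x L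
  ... | p , nothing = ((p , r) , nothing) ∷ []
  ... | p , just z  = ((p , r) , just z) ∷ rowTrail′ (suc r) z Ls

  rowTrail : Rows → A → Trail
  rowTrail T x = rowTrail′ 1 x T

  colTrail′ : ℕ → A → List (List A) → Trail
  colTrail′ c x [] = ((c , 1) , nothing) ∷ []
  colTrail′ c x (C ∷ Cs) with insSeq x C
  ... | p , nothing = ((c , p) , nothing) ∷ []
  ... | p , just z  = ((c , p) , just z) ∷ colTrail′ (suc c) z Cs

  colTrail : A → Rows → Trail
  colTrail x T = colTrail′ 1 x (columns T)

  boxes : Trail → List Box
  boxes = map proj₁

{-# OPTIONS --safe #-}
-- Along the row trail of T ← y the rows increase, the columns weakly
-- decrease (an element bumped from a column can only land in the same or an
-- earlier column of the next row) and the bumped labels increase.  Along the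
-- column trail of x → T the columns increase, each column is visited once and
-- the bumped labels increase.  A box on both trails carries the same label of T
-- on both.  So if two common boxes lay in rows r < r′, the second would be
-- weakly left of the first; the same column is excluded by the column trail,
-- and a strictly smaller column makes the two trails order the labels of the
-- two boxes in opposite ways.
module Submission where

open import Defs
open import Level using (Level)
open import Data.List.Membership.Propositional using (_∈_; _∉_)
open import Relation.Binary.Core using (Rel)
open import Relation.Binary.Structures using (IsStrictTotalOrder)
open import Relation.Binary.PropositionalEquality
  using (_≡_; _≢_; refl; sym; trans; cong; subst; module ≡-Reasoning)
open import Data.Nat using (ℕ; zero; suc; _+_; _≤_; _<_; _≮_; z≤n; s≤s)
open import Data.Nat.Properties
  using (≤-refl; ≤-reflexive; ≤-trans; <⇒≤; <⇒≱; n≮n; <-cmp; <-≤-connex; m≤n⇒m<n∨m≡n; +-identityʳ; +-suc)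
open import Data.Product using (∃; ∃₂; _×_; _,_; proj₁)
open import Data.Sum using (inj₁; inj₂)
open import Data.Maybe using (Maybe; just; nothing; _>>=_)
open import Data.Maybe.Relation.Unary.All using (just; nothing) renaming (All to AllMaybe)
import Data.Maybe.Relation.Unary.All as AllMaybe
open import Data.List using (List; []; _∷_; length; map; mapMaybe; upTo; applyUpTo)
open import Data.List.Properties using (map-upTo; length-map; length-upTo)
open import Data.List.Relation.Unary.Any using (here; there)
open import Data.List.Relation.Unary.Linked using (Linked; []; [-]; _∷_)
import Data.List.Relation.Unary.Linked as Linked
open import Data.List.Membership.Propositional.Properties using (∈-map⁻)
open import Data.Empty using (⊥-elim)
open import Relation.Nullary using (yes; no)
open import Relation.Binary.Definitions using (tri<; tri≈; tri>)

private
  variable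
    a : Level
    A : Set a

nth-≥length : ∀ j (R : List A) → length R ≤ j → nth j R ≡ nothing
nth-≥length j       []      _         = refl
nth-≥length (suc j) (_ ∷ R) (s≤s len≤) = nth-≥length j R len≤

nth-nothing⇒≥length : ∀ j (R : List A) → nth j R ≡ nothing → length R ≤ j
nth-nothing⇒≥length j       []      _  = z≤n
nth-nothing⇒≥length (suc j) (_ ∷ R) eq = s≤s (nth-nothing⇒≥length j R eq)

nth-just⇒<length : ∀ j (R : List A) {v} → nth j R ≡ just v → j < length R
nth-just⇒<length zero    (_ ∷ R) _  = s≤s z≤n
nth-just⇒<length (suc j) (_ ∷ R) eq = s≤s (nth-just⇒<length j R eq)

<length⇒nth-just : ∀ j (R : List A) → j < length R → ∃ λ v → nth j R ≡ just v
<length⇒nth-just zero    (v ∷ R) _         = v , refl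
<length⇒nth-just (suc j) (_ ∷ R) (s≤s j<n) = <length⇒nth-just j R j<n

nth-applyUpTo : ∀ (f : ℕ → A) {n j} → j < n → nth j (applyUpTo f n) ≡ just (f j)
nth-applyUpTo f {suc n} {zero}  _         = refl
nth-applyUpTo f {suc n} {suc j} (s≤s j<n) = nth-applyUpTo (λ i → f (suc i)) j<n

-- Unlike the boxes of a trail, line and position are 0-based here.
entry : List (List A) → ℕ → ℕ → Maybe A
entry Ls d q = nth d Ls >>= nth q

module Trails {a ℓ} {A : Set a} {_≺_ : Rel A ℓ} (sto : IsStrictTotalOrder _≡_ _≺_) where
  open Tableaux sto
  open IsStrictTotalOrder sto using (_<?_; asym) renaming (trans to ≺-trans)
  open IsTableau using (shape; colsIncr)

  LengthsDecr-tail : ∀ {R Rs} → LengthsDecr (R ∷ Rs) → LengthsDecr Rs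
  LengthsDecr-tail [ _ ]    = []
  LengthsDecr-tail (_ ∷ ld) = ld

  entry-≥length : ∀ {R Rs j} → LengthsDecr (R ∷ Rs) → length R ≤ j → ∀ i → entry (R ∷ Rs) i j ≡ nothing
  entry-≥length {R} {j = j} _ len≤ zero = nth-≥length j R len≤
  entry-≥length [ _ ]      len≤ (suc i) = refl
  entry-≥length (l ∷ ld)   len≤ (suc i) = entry-≥length ld (≤-trans l len≤) i

  nth-column : ∀ T i j → LengthsDecr T → nth i (mapMaybe (nth j) T) ≡ entry T i j
  nth-column []       i j _ = refl
  nth-column (R ∷ Rs) i j ld with nth j R in eq
  nth-column (R ∷ Rs) zero    j ld | just v = sym eq
  nth-column (R ∷ Rs) (suc i) j ld | just v = nth-column Rs i j (LengthsDecr-tail ld)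
  nth-column (R ∷ Rs) i       j ld | nothing = begin
    nth i (mapMaybe (nth j) Rs) ≡⟨ nth-column Rs i j (LengthsDecr-tail ld) ⟩
    entry (R ∷ Rs) (suc i) j    ≡⟨ entry-≥length ld len≤ (suc i) ⟩
    nothing                     ≡⟨ sym (entry-≥length ld len≤ i) ⟩
    entry (R ∷ Rs) i j          ∎
    where
      open ≡-Reasoning
      len≤ : length R ≤ j
      len≤ = nth-nothing⇒≥length j R eq

  entry-columns : ∀ T i j → LengthsDecr T → entry (columns T) j i ≡ entry T i j
  entry-columns []       i j _  = refl
  entry-columns (R ∷ Rs) i j ld with <-≤-connex j (length R)
  ... | inj₁ j<n = begin
    entry (columns (R ∷ Rs)) j i           ≡⟨ cong (λ Cs → entry Cs j i) (map-upTo column (length R)) ⟩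
    entry (applyUpTo column (length R)) j i ≡⟨ cong (_>>= nth i) (nth-applyUpTo column j<n) ⟩
    nth i (column j)                       ≡⟨ nth-column (R ∷ Rs) i j ld ⟩
    entry (R ∷ Rs) i j                     ∎
    where
      open ≡-Reasoning
      column : ℕ → List A
      column k = mapMaybe (nth k) (R ∷ Rs)
  ... | inj₂ n≤j = begin
    entry (columns (R ∷ Rs)) j i ≡⟨ cong (_>>= nth i) (nth-≥length j (columns (R ∷ Rs)) len≤) ⟩
    nothing                      ≡⟨ sym (entry-≥length ld n≤j i) ⟩
    entry (R ∷ Rs) i j           ∎
    where
      open ≡-Reasoning
      len≤ : length (columns (R ∷ Rs)) ≤ j
      len≤ = ≤-trans (≤-reflexive (trans (length-map _ (upTo (length R))) (length-upTo (length R)))) n≤j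

  Below : Rel (List A) (a Level.⊔ ℓ)
  Below L L′ = ∀ i {v} → nth i L′ ≡ just v → ∃ λ u → nth i L ≡ just u × u ≺ v

  Below-nth : ∀ {L L′ q z w} → Below L L′ → nth q L ≡ just z → nth q L′ ≡ just w → z ≺ w
  Below-nth L◁L′ eq eq′ with L◁L′ _ eq′
  ... | u , eqᵤ , u≺w with trans (sym eq) eqᵤ
  ...   | refl = u≺w

  ColumnStrict⇒Below : ∀ {R R′} → length R′ ≤ length R → ColumnStrict R R′ → Below R R′
  ColumnStrict⇒Below {R} {R′} len≤ strict i eq′ with <length⇒nth-just i R (≤-trans (nth-just⇒<length i R′ eq′) len≤)
  ... | u , eq = u , eq , strict i u _ eq eq′

  rows-Below : ∀ {T} → LengthsDecr T → ColumnsIncr T → Linked Below T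
  rows-Below []                  _         = []
  rows-Below [ _ ]               _         = [-]
  rows-Below (_∷_ {R} {R′} l ld) (cs ∷ ci) = ColumnStrict⇒Below {R} {R′} l cs ∷ rows-Below ld ci

  insSeq-position : ∀ x L {p m} → insSeq x L ≡ (p , m) → ∃ λ q → p ≡ suc q × nth q L ≡ m
  insSeq-position x []       refl = 0 , refl , refl
  insSeq-position x (w ∷ ws) eq with x <? w
  insSeq-position x (w ∷ ws) refl | yes _ = 0 , refl , refl
  ... | no _ with insSeq x ws in eq′
  insSeq-position x (w ∷ ws) refl | no _ | _ with insSeq-position x ws eq′
  ... | q , refl , nth≡ = suc q , refl , nth≡

  insSeq-bumps> : ∀ x L {p z} → insSeq x L ≡ (p , just z) → x ≺ z
  insSeq-bumps> x (w ∷ ws) eq with x <? w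
  insSeq-bumps> x (w ∷ ws) refl | yes x≺w = x≺w
  ... | no _ with insSeq x ws in eq′
  insSeq-bumps> x (w ∷ ws) refl | no _ | _ = insSeq-bumps> x ws eq′

  insSeq-position≤ : ∀ x L q → (∀ {w} → nth q L ≡ just w → x ≺ w) → proj₁ (insSeq x L) ≤ suc q
  insSeq-position≤ x []       q       _ = s≤s z≤n
  insSeq-position≤ x (w ∷ ws) q       x≺ with x <? w
  ... | yes _ = s≤s z≤n
  insSeq-position≤ x (w ∷ ws) zero    x≺ | no x⊀w = ⊥-elim (x⊀w (x≺ refl))
  insSeq-position≤ x (w ∷ ws) (suc q) x≺ | no _ with insSeq x ws | insSeq-position≤ x ws q x≺
  ... | _ | p≤ = s≤s p≤

  -- Entries (line, 1-based position, label): row and column trails are both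
  -- this trail, read on the rows resp. the columns of T.
  Entry : Set a
  Entry = ℕ × ℕ × Maybe A

  lineTrail : ℕ → A → List (List A) → List Entry
  lineTrail k x [] = (k , 1 , nothing) ∷ []
  lineTrail k x (L ∷ Ls) with insSeq x L
  ... | p , nothing = (k , p , nothing) ∷ []
  ... | p , just z  = (k , p , just z) ∷ lineTrail (suc k) z Ls

  rowEntry colEntry : Entry → Box × Maybe A
  rowEntry (k , p , m) = (p , k) , m
  colEntry (k , p , m) = (k , p) , m

  rowTrail′-lineTrail : ∀ r x Ls → rowTrail′ r x Ls ≡ map rowEntry (lineTrail r x Ls)
  rowTrail′-lineTrail r x []       = refl
  rowTrail′-lineTrail r x (L ∷ Ls) with insSeq x L
  ... | p , nothing = refl
  ... | p , just z  = cong (_ ∷_) (rowTrail′-lineTrail (suc r) z Ls)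

  colTrail′-lineTrail : ∀ c x Ls → colTrail′ c x Ls ≡ map colEntry (lineTrail c x Ls)
  colTrail′-lineTrail c x []       = refl
  colTrail′-lineTrail c x (L ∷ Ls) with insSeq x L
  ... | p , nothing = refl
  ... | p , just z  = cong (_ ∷_) (colTrail′-lineTrail (suc c) z Ls)

  ∈-rowTrail′ : ∀ r x Ls {c k} → (c , k) ∈ boxes (rowTrail′ r x Ls) → ∃ λ m → (k , c , m) ∈ lineTrail r x Ls
  ∈-rowTrail′ r x Ls mem rewrite rowTrail′-lineTrail r x Ls with ∈-map⁻ proj₁ mem
  ... | _ , mem′ , refl with ∈-map⁻ rowEntry mem′
  ...   | (_ , _ , m) , e∈ , refl = m , e∈

  ∈-colTrail′ : ∀ c₀ x Ls {c k} → (c , k) ∈ boxes (colTrail′ c₀ x Ls) → ∃ λ m → (c , k , m) ∈ lineTrail c₀ x Ls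
  ∈-colTrail′ c₀ x Ls mem rewrite colTrail′-lineTrail c₀ x Ls with ∈-map⁻ proj₁ mem
  ... | _ , mem′ , refl with ∈-map⁻ colEntry mem′
  ...   | (_ , _ , m) , e∈ , refl = m , e∈

  lineTrail-start≤ : ∀ k₀ x Ls {k p m} → (k , p , m) ∈ lineTrail k₀ x Ls → k₀ ≤ k
  lineTrail-start≤ k₀ x []       (here refl) = ≤-refl
  lineTrail-start≤ k₀ x (L ∷ Ls) mem with insSeq x L | mem
  ... | p , nothing | here refl = ≤-refl
  ... | p , just z  | here refl = ≤-refl
  ... | p , just z  | there mem′ = <⇒≤ (lineTrail-start≤ (suc k₀) z Ls mem′)

  lineTrail-∉ : ∀ k₀ x Ls {k p m} → k ≤ k₀ → (k , p , m) ∉ lineTrail (suc k₀) x Ls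
  lineTrail-∉ k₀ x Ls k≤k₀ mem = <⇒≱ (s≤s k≤k₀) (lineTrail-start≤ (suc k₀) x Ls mem)

  lineTrail-entry : ∀ k₀ x Ls {k p m} → (k , p , m) ∈ lineTrail k₀ x Ls →
                    ∃₂ λ d q → k ≡ k₀ + d × p ≡ suc q × entry Ls d q ≡ m
  lineTrail-entry k₀ x [] (here refl) = 0 , 0 , sym (+-identityʳ k₀) , refl , refl
  lineTrail-entry k₀ x (L ∷ Ls) mem with insSeq x L in eq | mem
  ... | p , nothing | here refl = let q , p≡ , nth≡ = insSeq-position x L eq in
                                  0 , q , sym (+-identityʳ k₀) , p≡ , nth≡
  ... | p , just z  | here refl = let q , p≡ , nth≡ = insSeq-position x L eq in
                                  0 , q , sym (+-identityʳ k₀) , p≡ , nth≡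
  ... | p , just z  | there mem′ with lineTrail-entry (suc k₀) z Ls mem′
  ...   | d , q , k≡ , p≡ , entry≡ = suc d , q , trans k≡ (sym (+-suc k₀ d)) , p≡ , entry≡

  lineTrail-position-unique : ∀ k₀ x Ls {k p p′ m m′} →
    (k , p , m) ∈ lineTrail k₀ x Ls → (k , p′ , m′) ∈ lineTrail k₀ x Ls → p ≡ p′
  lineTrail-position-unique k₀ x [] (here refl) (here refl) = refl
  lineTrail-position-unique k₀ x (L ∷ Ls) mem mem′ with insSeq x L | mem | mem′
  ... | p , nothing | here refl  | here refl  = refl
  ... | p , just z  | here refl  | here refl  = refl
  ... | p , just z  | here refl  | there mem₂ = ⊥-elim (lineTrail-∉ k₀ z Ls ≤-refl mem₂)
  ... | p , just z  | there mem₁ | here refl  = ⊥-elim (lineTrail-∉ k₀ z Ls ≤-refl mem₁)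
  ... | p , just z  | there mem₁ | there mem₂ = lineTrail-position-unique (suc k₀) z Ls mem₁ mem₂

  lineTrail-labels> : ∀ k₀ x Ls {k p m} → (k , p , m) ∈ lineTrail k₀ x Ls → AllMaybe (x ≺_) m
  lineTrail-labels> k₀ x [] (here refl) = nothing
  lineTrail-labels> k₀ x (L ∷ Ls) mem with insSeq x L in eq | mem
  ... | p , nothing | here refl  = nothing
  ... | p , just z  | here refl  = just (insSeq-bumps> x L eq)
  ... | p , just z  | there mem′ =
    AllMaybe.map (≺-trans (insSeq-bumps> x L eq)) (lineTrail-labels> (suc k₀) z Ls mem′)

  lineTrail-labels-increase : ∀ k₀ x Ls {k₁ p₁ m₁ k₂ p₂ m₂} →
    (k₁ , p₁ , m₁) ∈ lineTrail k₀ x Ls → (k₂ , p₂ , m₂) ∈ lineTrail k₀ x Ls → k₁ < k₂ →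
    ∃ λ z₁ → m₁ ≡ just z₁ × AllMaybe (z₁ ≺_) m₂
  lineTrail-labels-increase k₀ x [] (here refl) (here refl) k<k = ⊥-elim (n≮n k₀ k<k)
  lineTrail-labels-increase k₀ x (L ∷ Ls) mem₁ mem₂ k₁<k₂ with insSeq x L | mem₁ | mem₂
  ... | p , nothing | here refl | here refl = ⊥-elim (n≮n k₀ k₁<k₂)
  ... | p , just z  | here refl | here refl = ⊥-elim (n≮n k₀ k₁<k₂)
  ... | p , just z  | here refl | there m₂  = z , refl , lineTrail-labels> (suc k₀) z Ls m₂
  ... | p , just z  | there m₁  | here refl = ⊥-elim (lineTrail-∉ k₀ z Ls (<⇒≤ k₁<k₂) m₁)
  ... | p , just z  | there m₁  | there m₂  = lineTrail-labels-increase (suc k₀) z Ls m₁ m₂ k₁<k₂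

  lineTrail-position≤ : ∀ L Ls q z k₀ {k p m} → Linked Below (L ∷ Ls) → nth q L ≡ just z →
                        (k , p , m) ∈ lineTrail k₀ z Ls → p ≤ suc q
  lineTrail-position≤ L [] q z k₀ _ _ (here refl) = s≤s z≤n
  lineTrail-position≤ L (L′ ∷ Ls) q z k₀ (L◁L′ ∷ below) nth≡ mem
    with insSeq z L′ in eq | insSeq-position≤ z L′ q (Below-nth {L} {L′} L◁L′ nth≡) | mem
  ... | p , nothing | p≤ | here refl = p≤
  ... | p , just z′ | p≤ | here refl = p≤
  ... | p , just z′ | p≤ | there mem′ with insSeq-position z L′ eq
  ...   | q′ , refl , nth≡′ = ≤-trans (lineTrail-position≤ L′ Ls q′ z′ (suc k₀) below nth≡′ mem′) p≤

  lineTrail-positions-decrease : ∀ k₀ x Ls {k₁ p₁ m₁ k₂ p₂ m₂} → Linked Below Ls →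
    (k₁ , p₁ , m₁) ∈ lineTrail k₀ x Ls → (k₂ , p₂ , m₂) ∈ lineTrail k₀ x Ls → k₁ < k₂ → p₂ ≤ p₁
  lineTrail-positions-decrease k₀ x [] _ (here refl) (here refl) k<k = ⊥-elim (n≮n k₀ k<k)
  lineTrail-positions-decrease k₀ x (L ∷ Ls) below mem₁ mem₂ k₁<k₂ with insSeq x L in eq | mem₁ | mem₂
  ... | p , nothing | here refl | here refl = ⊥-elim (n≮n k₀ k₁<k₂)
  ... | p , just z  | here refl | here refl = ⊥-elim (n≮n k₀ k₁<k₂)
  ... | p , just z  | there m₁  | here refl = ⊥-elim (lineTrail-∉ k₀ z Ls (<⇒≤ k₁<k₂) m₁)
  ... | p , just z  | there m₁  | there m₂  =
    lineTrail-positions-decrease (suc k₀) z Ls (Linked.tail below) m₁ m₂ k₁<k₂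
  ... | p , just z  | here refl | there m₂ with insSeq-position x L eq
  ...   | q , refl , nth≡ = lineTrail-position≤ L Ls q z (suc k₀) below nth≡ m₂

  Shared : Rows → A → A → Box → Set
  Shared T x y b = b ∈ boxes (colTrail x T) × b ∈ boxes (rowTrail T y)

  shared-label : ∀ {T x y c r m n} → LengthsDecr T →
    (r , c , m) ∈ lineTrail 1 y T → (c , r , n) ∈ lineTrail 1 x (columns T) → m ≡ n
  shared-label {T} {x} {y} ld er ec with lineTrail-entry 1 y T er | lineTrail-entry 1 x (columns T) ec
  ... | d , q , refl , refl , entry≡ | _ , _ , refl , refl , entry≡′ =
    trans (sym entry≡) (trans (sym (entry-columns T d q ld)) entry≡′)

  shared-rows≮ : ∀ {T x y c r c′ r′} → IsTableau T → Shared T x y (c , r) → Shared T x y (c′ , r′) → r ≮ r′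
  shared-rows≮ {T} {x} {y} isT (c∈ , r∈) (c′∈ , r′∈) r<r′
    with ∈-colTrail′ 1 x (columns T) c∈ | ∈-rowTrail′ 1 y T r∈ | ∈-colTrail′ 1 x (columns T) c′∈ | ∈-rowTrail′ 1 y T r′∈
  ... | _ , ec | _ , er | _ , ec′ | _ , er′
    with shared-label (shape isT) er ec | shared-label (shape isT) er′ ec′
       | lineTrail-labels-increase 1 y T er er′ r<r′
       | m≤n⇒m<n∨m≡n (lineTrail-positions-decrease 1 y T (rows-Below (shape isT) (colsIncr isT)) er er′ r<r′)
  ... | refl | refl | _ , refl , _ | inj₂ refl =
    n≮n _ (subst (_< _) (lineTrail-position-unique 1 x (columns T) ec ec′) r<r′)
  ... | refl | refl | z , refl , z≺m′ | inj₁ c′<c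
    with lineTrail-labels-increase 1 x (columns T) ec′ ec c′<c
  ...   | z′ , refl , just z′≺z = asym (AllMaybe.drop-just z≺m′) z′≺z

open Trails

lemma3 : ∀ {a ℓ} {A : Set a} {_<_ : Rel A ℓ} (sto : IsStrictTotalOrder _≡_ _<_) →
    let open Tableaux sto in
    (T : Rows) → IsTableau T → (x y : A) → x ≢ y → x ∉ labels T → y ∉ labels T →
    (b b′ : Box) →
    b ∈ boxes (colTrail x T) → b ∈ boxes (rowTrail T y) →
    b′ ∈ boxes (colTrail x T) → b′ ∈ boxes (rowTrail T y) →
    b ≡ b′
lemma3 sto T isT x y _ _ _ (c , r) (c′ , r′) c∈ r∈ c′∈ r′∈ with <-cmp r r′
... | tri< r<r′ _ _ = ⊥-elim (shared-rows≮ sto isT (c∈ , r∈) (c′∈ , r′∈) r<r′)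
... | tri> _ _ r′<r = ⊥-elim (shared-rows≮ sto isT (c′∈ , r′∈) (c∈ , r∈) r′<r)
... | tri≈ _ refl _ with ∈-rowTrail′ sto 1 y T r∈ | ∈-rowTrail′ sto 1 y T r′∈
...   | _ , er | _ , er′ = cong (_, r) (lineTrail-position-unique sto 1 y T er er′)
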